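{- Let $G$ be a simple connected graph with vertex set $V(G)=\{v_1,\dots,v_n\}$ and edge set $E(G)$, and write $d(v_i)=d_G(v_i)$ for the degree of $v_i$ in $G$. Let $t_1,\dots,t_n$ be nonnegative integers and let $r\ge 3$ be an integer. Let $G_C$ be the graph obtained from $G$ by attaching, for each $i$, $t_i$ copies of the cycle $C_r$ of length $r$ to $v_i$, where $v_i$ is identified with one vertex of each such cycle, and distinct attached cycles are otherwise vertex-disjoint from each other and from $G$. Then $$HM(G_C)=HM(G)+4\sum_{v_iv_j\in E(G)}\left[d(v_i)+d(v_j)\right](t_i+t_j)+4\sum_{v_iv_j\in E(G)}(t_i+t_j)^2+2\sum_{i=1}^n t_i d(v_i)^2+8\sum_{i=1}^n\left[d(v_i)t_i^2+d(v_i)t_i+t_i^3+2t_i^2\right]+(16r-24)\sum_{i=1}^n t_i.$$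
   Context: For a graph $H$, the hyper Zagreb index is $HM(H)=\sum_{uv\in E(H)}\left[d_H(u)+d_H(v)\right]^2$, where $d_H(x)$ is the degree of $x$ in $H$. In the sums over $E(G)$, each edge $v_iv_j$ of $G$ is counted once. -}

module Defs where

open import Data.Nat using (ℕ; zero; suc; _+_; _*_; _∸_; _^_; _≡ᵇ_)
open import Data.Bool using (Bool; true; false; if_then_else_; _∧_; _∨_)
open import Data.Fin using (Fin; toℕ)
open import Data.Fin.Properties using (_≟_)
open import Data.List using (List; []; _∷_; _++_; map; concatMap; allFin)
open import Data.Nat.ListAction using (sum)
open import Data.Product using (Σ; _×_; _,_)
open import Data.Sum using (_⊎_; inj₁; inj₂)
open import Relation.Nullary.Decidable using (⌊_⌋)
open import Relation.Binary.PropositionalEquality using (_≡_)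

-- A finite graph given by an enumeration of its vertex set (each vertex
-- listed exactly once) and a Boolean adjacency relation.
record Graph : Set₁ where
  field
    V     : Set
    verts : List V
    adj   : V → V → Bool
open Graph public

deg : (H : Graph) → V H → ℕ
deg H v = sum (map (λ u → if adj H v u then 1 else 0) (verts H))

pairs : {A : Set} → List A → List (A × A)
pairs []       = []
pairs (x ∷ xs) = map (λ y → (x , y)) xs ++ pairs xs

sumE : (H : Graph) → (V H → V H → ℕ) → ℕ
sumE H f = sum (map (λ { (u , v) → if adj H u v then f u v else 0 }) (pairs (verts H)))

HM : Graph → ℕ
HM H = sumE H (λ u v → (deg H u + deg H v) ^ 2)

sumV : (n : ℕ) → (Fin n → ℕ) → ℕ
sumV n f = sum (map f (allFin n))

finGraph : (n : ℕ) → (Fin n → Fin n → Bool) → Graph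
finGraph n a = record { V = Fin n ; verts = allFin n ; adj = a }

Symmetric : {n : ℕ} → (Fin n → Fin n → Bool) → Set
Symmetric {n} a = (i j : Fin n) → a i j ≡ a j i

Irreflexive : {n : ℕ} → (Fin n → Fin n → Bool) → Set
Irreflexive {n} a = (i : Fin n) → a i i ≡ false

data Reach {n : ℕ} (a : Fin n → Fin n → Bool) : Fin n → Fin n → Set where
  here : ∀ {i} → Reach a i i
  step : ∀ {i j k} → a i j ≡ true → Reach a j k → Reach a i k

Connected : {n : ℕ} → (Fin n → Fin n → Bool) → Set
Connected {n} a = (i j : Fin n) → Reach a i j

-- Vertices of G_C: the original vertices v_i, plus, for each i, each copy
-- k < t_i of C_r attached at v_i, and each j < r-1, the j-th non-root
-- vertex c(i,k,j) of that cycle.  The cycle is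
--   v_i - c(i,k,0) - c(i,k,1) - ... - c(i,k,r-2) - v_i.
CVert : (n : ℕ) → (t : Fin n → ℕ) → (r : ℕ) → Set
CVert n t r = Fin n ⊎ Σ (Fin n) (λ i → Fin (t i) × Fin (r ∸ 1))

eqFin : {n : ℕ} → Fin n → Fin n → Bool
eqFin i j = ⌊ i ≟ j ⌋

rootAdj : {n : ℕ} → (t : Fin n → ℕ) → (r : ℕ) →
          Fin n → Σ (Fin n) (λ i → Fin (t i) × Fin (r ∸ 1)) → Bool
rootAdj t r i (i' , k , j) = eqFin i i' ∧ ((toℕ j ≡ᵇ 0) ∨ (toℕ j ≡ᵇ (r ∸ 2)))

cycAdj : {n : ℕ} → (t : Fin n → ℕ) → (r : ℕ) →
         Σ (Fin n) (λ i → Fin (t i) × Fin (r ∸ 1)) →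
         Σ (Fin n) (λ i → Fin (t i) × Fin (r ∸ 1)) → Bool
cycAdj t r (i , k , j) (i' , k' , j') =
  eqFin i i' ∧ (toℕ k ≡ᵇ toℕ k') ∧
  ((suc (toℕ j) ≡ᵇ toℕ j') ∨ (suc (toℕ j') ≡ᵇ toℕ j))

adjC : (n : ℕ) → (Fin n → Fin n → Bool) → (t : Fin n → ℕ) → (r : ℕ) →
       CVert n t r → CVert n t r → Bool
adjC n a t r (inj₁ i) (inj₁ j) = a i j
adjC n a t r (inj₁ i) (inj₂ c) = rootAdj t r i c
adjC n a t r (inj₂ c) (inj₁ i) = rootAdj t r i c
adjC n a t r (inj₂ c) (inj₂ c') = cycAdj t r c c'

vertsC : (n : ℕ) → (t : Fin n → ℕ) → (r : ℕ) → List (CVert n t r)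
vertsC n t r =
  map inj₁ (allFin n) ++
  concatMap (λ i → concatMap (λ k → map (λ j → inj₂ (i , k , j)) (allFin (r ∸ 1)))
                             (allFin (t i)))
            (allFin n)

GC : (n : ℕ) → (Fin n → Fin n → Bool) → (t : Fin n → ℕ) → (r : ℕ) → Graph
GC n a t r = record { V = CVert n t r ; verts = vertsC n t r ; adj = adjC n a t r }

-- In G_C every cycle vertex has degree 2 and v_i has degree d(v_i) + 2 t_i, so
-- the edges of G_C fall into three groups: the edges v_i v_j of G, now of
-- weight (d(v_i) + 2 t_i + d(v_j) + 2 t_j)²; the 2 t_i edges from v_i into its
-- cycles, of weight (d(v_i) + 2 t_i + 2)²; and the r - 2 remaining edges of each
-- attached cycle, of weight 16.  The last group is counted by the handshake
-- identity: the 2 neighbours of a cycle vertex are split between the path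
-- c(i,k,0) … c(i,k,r-2) and the root v_i.

module Submission where

open import Defs
open import Data.Nat using (ℕ; zero; suc; _+_; _*_; _∸_; _^_; _≡ᵇ_; _≤_; _<_; _≥_; s≤s; z≤n)
open import Data.Nat.Properties
open import Data.Nat.ListAction using (sum)
open import Data.Nat.ListAction.Properties using (sum-++)
open import Data.Nat.Tactic.RingSolver using (solve-∀)
open import Data.Nat.Solver using (module +-*-Solver)
open +-*-Solver using (solve; _:+_; _:*_; _:^_; _:=_; con)
open import Data.Bool using (Bool; true; false; if_then_else_; _∧_; _∨_; T)
open import Data.Bool.Properties using (∨-comm)
open import Data.Fin using (Fin; zero; suc; toℕ)
open import Data.Fin.Properties using (toℕ<n) renaming (_≟_ to _≟ᶠ_)
open import Data.List using (List; []; _∷_; _++_; map; concatMap; allFin)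
open import Data.List.Properties using (map-++; map-∘; map-tabulate; map-concatMap; concatMap-cong)
open import Data.Product using (Σ; _×_; _,_; uncurry)
open import Data.Sum using (inj₁; inj₂)
open import Function using (_∘_)
open import Relation.Nullary.Decidable using (dec-true; isYes≗does; ⌊⌋-map′)
open import Relation.Binary.PropositionalEquality
open ≡-Reasoning

private variable
  A B : Set

∑ : List A → (A → ℕ) → ℕ
∑ xs f = sum (map f xs)

∑-++ : (xs ys : List A) (f : A → ℕ) → ∑ (xs ++ ys) f ≡ ∑ xs f + ∑ ys f
∑-++ xs ys f = trans (cong sum (map-++ f xs ys)) (sum-++ (map f xs) (map f ys))

∑-map : (g : A → B) (xs : List A) (f : B → ℕ) → ∑ (map g xs) f ≡ ∑ xs (f ∘ g)
∑-map g xs f = cong sum (sym (map-∘ xs))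

∑-cong : (xs : List A) {f g : A → ℕ} → (∀ x → f x ≡ g x) → ∑ xs f ≡ ∑ xs g
∑-cong []       f≗g = refl
∑-cong (x ∷ xs) f≗g = cong₂ _+_ (f≗g x) (∑-cong xs f≗g)

∑-zero : (xs : List A) {f : A → ℕ} → (∀ x → f x ≡ 0) → ∑ xs f ≡ 0
∑-zero []       f≗0 = refl
∑-zero (x ∷ xs) f≗0 = cong₂ _+_ (f≗0 x) (∑-zero xs f≗0)

∑-+ : (xs : List A) (f g : A → ℕ) → ∑ xs (λ x → f x + g x) ≡ ∑ xs f + ∑ xs g
∑-+ []       f g = refl
∑-+ (x ∷ xs) f g = trans (cong (f x + g x +_) (∑-+ xs f g))
                         (interchange (f x) (g x) (∑ xs f) (∑ xs g))
  where
  interchange : ∀ a b c d → a + b + (c + d) ≡ a + c + (b + d)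
  interchange = solve-∀

∑-* : (xs : List A) (k : ℕ) (f : A → ℕ) → ∑ xs (λ x → k * f x) ≡ k * ∑ xs f
∑-* []       k f = sym (*-zeroʳ k)
∑-* (x ∷ xs) k f = trans (cong (k * f x +_) (∑-* xs k f)) (sym (*-distribˡ-+ k (f x) _))

∑-linear : (xs : List A) (α β γ : ℕ) (f g h : A → ℕ) →
           ∑ xs (λ x → α * f x + β * g x + γ * h x) ≡ α * ∑ xs f + β * ∑ xs g + γ * ∑ xs h
∑-linear xs α β γ f g h =
  trans (∑-+ xs (λ x → α * f x + β * g x) (λ x → γ * h x))
        (cong₂ _+_ (trans (∑-+ xs (λ x → α * f x) (λ x → β * g x)) (cong₂ _+_ (∑-* xs α f) (∑-* xs β g)))
                   (∑-* xs γ h))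

∑-if : (xs : List A) (b : Bool) (f : A → ℕ) →
       ∑ xs (λ x → if b then f x else 0) ≡ (if b then ∑ xs f else 0)
∑-if xs true  f = refl
∑-if xs false f = ∑-zero xs (λ _ → refl)

∑-concatMap : (h : A → List B) (xs : List A) (f : B → ℕ) →
              ∑ (concatMap h xs) f ≡ ∑ xs (λ x → ∑ (h x) f)
∑-concatMap h []       f = refl
∑-concatMap h (x ∷ xs) f =
  trans (∑-++ (h x) (concatMap h xs) f) (cong (∑ (h x) f +_) (∑-concatMap h xs f))

∑-allFin-suc : (n : ℕ) (f : Fin (suc n) → ℕ) → ∑ (allFin (suc n)) f ≡ f zero + ∑ (allFin n) (f ∘ suc)
∑-allFin-suc n f =
  cong (λ fs → f zero + sum fs) (trans (map-tabulate suc f) (sym (map-tabulate (λ i → i) (f ∘ suc))))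

∑-allFin-const : (n c : ℕ) → ∑ (allFin n) (λ _ → c) ≡ n * c
∑-allFin-const zero    c = refl
∑-allFin-const (suc n) c = trans (∑-allFin-suc n (λ _ → c)) (cong (c +_) (∑-allFin-const n c))

∑pairs : List A → (A → A → ℕ) → ℕ
∑pairs xs F = ∑ (pairs xs) (uncurry F)

∑pairs-cons : (x : A) (xs : List A) (F : A → A → ℕ) → ∑pairs (x ∷ xs) F ≡ ∑ xs (F x) + ∑pairs xs F
∑pairs-cons x xs F =
  trans (∑-++ (map (x ,_) xs) (pairs xs) (uncurry F)) (cong (_+ ∑pairs xs F) (∑-map (x ,_) xs (uncurry F)))

∑pairs-++ : (xs ys : List A) (F : A → A → ℕ) →
            ∑pairs (xs ++ ys) F ≡ ∑pairs xs F + ∑ xs (λ x → ∑ ys (F x)) + ∑pairs ys F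
∑pairs-++ []       ys F = refl
∑pairs-++ (x ∷ xs) ys F = begin
  ∑pairs (x ∷ xs ++ ys) F                           ≡⟨ ∑pairs-cons x (xs ++ ys) F ⟩
  ∑ (xs ++ ys) (F x) + ∑pairs (xs ++ ys) F          ≡⟨ cong₂ _+_ (∑-++ xs ys (F x)) (∑pairs-++ xs ys F) ⟩
  ∑ xs (F x) + ∑ ys (F x) + (∑pairs xs F + X + ∑pairs ys F)
                                                    ≡⟨ regroup (∑ xs (F x)) (∑ ys (F x)) (∑pairs xs F) X (∑pairs ys F) ⟩
  ∑ xs (F x) + ∑pairs xs F + (∑ ys (F x) + X) + ∑pairs ys F
                                                    ≡⟨ cong (λ z → z + (∑ ys (F x) + X) + ∑pairs ys F) (sym (∑pairs-cons x xs F)) ⟩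
  ∑pairs (x ∷ xs) F + (∑ ys (F x) + X) + ∑pairs ys F ∎
  where
  X : ℕ
  X = ∑ xs (λ x → ∑ ys (F x))
  regroup : ∀ a b c d e → a + b + (c + d + e) ≡ a + c + (b + d) + e
  regroup = solve-∀

∑pairs-map : (g : A → B) (xs : List A) (F : B → B → ℕ) →
             ∑pairs (map g xs) F ≡ ∑pairs xs (λ x y → F (g x) (g y))
∑pairs-map g []       F = refl
∑pairs-map g (x ∷ xs) F = begin
  ∑pairs (g x ∷ map g xs) F                        ≡⟨ ∑pairs-cons (g x) (map g xs) F ⟩
  ∑ (map g xs) (F (g x)) + ∑pairs (map g xs) F     ≡⟨ cong₂ _+_ (∑-map g xs (F (g x))) (∑pairs-map g xs F) ⟩
  ∑ xs (F (g x) ∘ g) + ∑pairs xs (λ x y → F (g x) (g y)) ≡⟨ sym (∑pairs-cons x xs _) ⟩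
  ∑pairs (x ∷ xs) (λ x y → F (g x) (g y))          ∎

∑pairs-handshake : (xs : List A) (F : A → A → ℕ) → (∀ u v → F u v ≡ F v u) → (∀ u → F u u ≡ 0) →
                   ∑ xs (λ u → ∑ xs (F u)) ≡ 2 * ∑pairs xs F
∑pairs-handshake []       F F-sym F-diag = refl
∑pairs-handshake (x ∷ xs) F F-sym F-diag = begin
  F x x + ∑ xs (F x) + ∑ xs (λ u → F u x + ∑ xs (F u))
    ≡⟨ cong₂ (λ p q → p + ∑ xs (F x) + q) (F-diag x) (∑-+ xs (λ u → F u x) (λ u → ∑ xs (F u))) ⟩
  ∑ xs (F x) + (∑ xs (λ u → F u x) + ∑ xs (λ u → ∑ xs (F u)))
    ≡⟨ cong₂ (λ p q → ∑ xs (F x) + (p + q)) (∑-cong xs (λ u → F-sym u x)) (∑pairs-handshake xs F F-sym F-diag) ⟩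
  ∑ xs (F x) + (∑ xs (F x) + 2 * ∑pairs xs F)
    ≡⟨ double (∑ xs (F x)) (∑pairs xs F) ⟩
  2 * (∑ xs (F x) + ∑pairs xs F)
    ≡⟨ cong (2 *_) (sym (∑pairs-cons x xs F)) ⟩
  2 * ∑pairs (x ∷ xs) F ∎
  where
  double : ∀ a b → a + (a + 2 * b) ≡ 2 * (a + b)
  double = solve-∀

⟦_⟧ : Bool → ℕ
⟦ b ⟧ = if b then 1 else 0

if-then-0 : (b : Bool) (K : ℕ) → (if b then K else 0) ≡ K * ⟦ b ⟧
if-then-0 true  K = sym (*-identityʳ K)
if-then-0 false K = sym (*-zeroʳ K)

if-∧ : (b c : Bool) (K : ℕ) → (if b ∧ c then K else 0) ≡ (if b then (if c then K else 0) else 0)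
if-∧ true  c K = refl
if-∧ false c K = refl

eqFin-suc : {n : ℕ} (i j : Fin n) → eqFin (suc i) (suc j) ≡ eqFin i j
eqFin-suc i j = ⌊⌋-map′ _ _ (i ≟ᶠ j)

eqFin-refl : {n : ℕ} (i : Fin n) → eqFin i i ≡ true
eqFin-refl i = trans (isYes≗does (i ≟ᶠ i)) (dec-true (i ≟ᶠ i) refl)

eqFin-sym : {n : ℕ} (i j : Fin n) → eqFin i j ≡ eqFin j i
eqFin-sym zero    zero    = refl
eqFin-sym zero    (suc j) = refl
eqFin-sym (suc i) zero    = refl
eqFin-sym (suc i) (suc j) = trans (eqFin-suc i j) (trans (eqFin-sym i j) (sym (eqFin-suc j i)))

≡ᵇ-refl : (x : ℕ) → (x ≡ᵇ x) ≡ true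
≡ᵇ-refl zero    = refl
≡ᵇ-refl (suc x) = ≡ᵇ-refl x

≡ᵇ-sym : (x y : ℕ) → (x ≡ᵇ y) ≡ (y ≡ᵇ x)
≡ᵇ-sym zero    zero    = refl
≡ᵇ-sym zero    (suc y) = refl
≡ᵇ-sym (suc x) zero    = refl
≡ᵇ-sym (suc x) (suc y) = ≡ᵇ-sym x y

suc≢ᵇ : (x : ℕ) → (suc x ≡ᵇ x) ≡ false
suc≢ᵇ zero    = refl
suc≢ᵇ (suc x) = suc≢ᵇ x

∑-eqFin : {n : ℕ} (i : Fin n) (f : Fin n → ℕ) → ∑ (allFin n) (λ j → if eqFin i j then f j else 0) ≡ f i
∑-eqFin {suc n} zero f = begin
  ∑ (allFin (suc n)) (λ j → if eqFin zero j then f j else 0) ≡⟨ ∑-allFin-suc n _ ⟩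
  f zero + ∑ (allFin n) (λ _ → 0)                           ≡⟨ cong (f zero +_) (∑-zero (allFin n) (λ _ → refl)) ⟩
  f zero + 0                                                 ≡⟨ +-identityʳ (f zero) ⟩
  f zero                                                     ∎
∑-eqFin {suc n} (suc i) f = begin
  ∑ (allFin (suc n)) (λ j → if eqFin (suc i) j then f j else 0)
    ≡⟨ ∑-allFin-suc n (λ j → if eqFin (suc i) j then f j else 0) ⟩
  ∑ (allFin n) (λ j → if eqFin (suc i) (suc j) then f (suc j) else 0)
    ≡⟨ ∑-cong (allFin n) (λ j → cong (λ b → if b then f (suc j) else 0) (eqFin-suc i j)) ⟩
  ∑ (allFin n) (λ j → if eqFin i j then f (suc j) else 0)         ≡⟨ ∑-eqFin i (f ∘ suc) ⟩
  f (suc i)                                                        ∎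

∑-toℕ≡ᵇ : (n p K : ℕ) → p < n → ∑ (allFin n) (λ j → if toℕ j ≡ᵇ p then K else 0) ≡ K
∑-toℕ≡ᵇ (suc n) zero K _ =
  trans (∑-allFin-suc n (λ j → if toℕ j ≡ᵇ 0 then K else 0)) (trans (cong (K +_) (∑-zero (allFin n) (λ _ → refl))) (+-identityʳ K))
∑-toℕ≡ᵇ (suc n) (suc p) K (s≤s p<n) =
  trans (∑-allFin-suc n (λ j → if toℕ j ≡ᵇ suc p then K else 0)) (∑-toℕ≡ᵇ n p K p<n)

∑-toℕ≡ᵇ-≥ : (n p K : ℕ) → n ≤ p → ∑ (allFin n) (λ j → if toℕ j ≡ᵇ p then K else 0) ≡ 0
∑-toℕ≡ᵇ-≥ zero    p       K _         = refl
∑-toℕ≡ᵇ-≥ (suc n) (suc p) K (s≤s n≤p) =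
  trans (∑-allFin-suc n (λ j → if toℕ j ≡ᵇ suc p then K else 0)) (∑-toℕ≡ᵇ-≥ n p K n≤p)

-- The non-root vertices of an attached C_(s+3) form the path 0 — 1 — … — s+1,
-- whose two ends are the neighbours of the root.

pathAdj : ℕ → ℕ → Bool
pathAdj x y = (suc x ≡ᵇ y) ∨ (suc y ≡ᵇ x)

pathEnd : ℕ → ℕ → Bool
pathEnd s x = (x ≡ᵇ 0) ∨ (x ≡ᵇ suc s)

pathAdj-sym : (x y : ℕ) → pathAdj x y ≡ pathAdj y x
pathAdj-sym x y = ∨-comm (suc x ≡ᵇ y) (suc y ≡ᵇ x)

⟦pathAdj⟧-split : (x y : ℕ) → ⟦ pathAdj x y ⟧ ≡ ⟦ y ≡ᵇ suc x ⟧ + ⟦ suc y ≡ᵇ x ⟧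
⟦pathAdj⟧-split zero    zero          = refl
⟦pathAdj⟧-split zero    (suc zero)    = refl
⟦pathAdj⟧-split zero    (suc (suc y)) = refl
⟦pathAdj⟧-split (suc x) zero          = refl
⟦pathAdj⟧-split (suc x) (suc y)       = ⟦pathAdj⟧-split x y

∑-pathEnd : (s K : ℕ) → ∑ (allFin (2 + s)) (λ j → if pathEnd s (toℕ j) then K else 0) ≡ 2 * K
∑-pathEnd s K = begin
  ∑ (allFin (2 + s)) (λ j → if pathEnd s (toℕ j) then K else 0)
    ≡⟨ ∑-allFin-suc (suc s) (λ j → if pathEnd s (toℕ j) then K else 0) ⟩
  K + ∑ (allFin (suc s)) (λ j → if toℕ j ≡ᵇ s then K else 0)
    ≡⟨ cong (K +_) (trans (∑-toℕ≡ᵇ (suc s) s K ≤-refl) (sym (+-identityʳ K))) ⟩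
  2 * K ∎

pathEnd+pathDegree : (s x : ℕ) → x < 2 + s →
                     ⟦ pathEnd s x ⟧ + ∑ (allFin (2 + s)) (λ j → ⟦ pathAdj x (toℕ j) ⟧) ≡ 2
pathEnd+pathDegree s x x<2+s = begin
  ⟦ pathEnd s x ⟧ + ∑ (allFin (2 + s)) (λ j → ⟦ pathAdj x (toℕ j) ⟧)
    ≡⟨ cong (⟦ pathEnd s x ⟧ +_) (trans (∑-cong (allFin (2 + s)) (λ j → ⟦pathAdj⟧-split x (toℕ j)))
                                       (∑-+ (allFin (2 + s)) (λ j → ⟦ toℕ j ≡ᵇ suc x ⟧) (λ j → ⟦ suc (toℕ j) ≡ᵇ x ⟧))) ⟩
  ⟦ pathEnd s x ⟧ + (successors x + predecessors x)
    ≡⟨ count x x<2+s ⟩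
  2 ∎
  where
  successors predecessors : ℕ → ℕ
  successors   x = ∑ (allFin (2 + s)) (λ j → ⟦ toℕ j ≡ᵇ suc x ⟧)
  predecessors x = ∑ (allFin (2 + s)) (λ j → ⟦ suc (toℕ j) ≡ᵇ x ⟧)

  count : (x : ℕ) → x < 2 + s → ⟦ pathEnd s x ⟧ + (successors x + predecessors x) ≡ 2
  count zero _ =
    cong₂ (λ p q → 1 + (p + q)) (∑-toℕ≡ᵇ (2 + s) 1 1 (s≤s (s≤s z≤n))) (∑-zero (allFin (2 + s)) (λ _ → refl))
  count (suc y) (s≤s y≤s) with y ≡ᵇ s in y≡ᵇs
  ... | true  = cong₂ (λ p q → 1 + (p + q))
                  (subst (λ z → successors (suc z) ≡ 0) (sym y≡s) (∑-toℕ≡ᵇ-≥ (2 + s) (2 + s) 1 ≤-refl))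
                  (∑-toℕ≡ᵇ (2 + s) y 1 (m≤n⇒m≤1+n y≤s))
    where
    y≡s : y ≡ s
    y≡s = ≡ᵇ⇒≡ y s (subst T (sym y≡ᵇs) _)
  ... | false = cong₂ (λ p q → 0 + (p + q))
                  (∑-toℕ≡ᵇ (2 + s) (2 + y) 1 (s≤s (s≤s (≤∧≢⇒< (≤-pred y≤s) y≢s))))
                  (∑-toℕ≡ᵇ (2 + s) y 1 (m≤n⇒m≤1+n y≤s))
    where
    y≢s : y ≢ s
    y≢s y≡s = subst T y≡ᵇs (≡⇒≡ᵇ y s y≡s)

∑∑-pathAdj : (s : ℕ) → ∑ (allFin (2 + s)) (λ j → ∑ (allFin (2 + s)) (λ j' → ⟦ pathAdj (toℕ j) (toℕ j') ⟧)) ≡ 2 * (1 + s)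
∑∑-pathAdj s = +-cancelˡ-≡ 2 _ _ (begin
  2 + degrees                                          ≡⟨ cong (_+ degrees) (sym (∑-pathEnd s 1)) ⟩
  ∑ (allFin (2 + s)) (λ j → ⟦ pathEnd s (toℕ j) ⟧) + degrees
    ≡⟨ sym (∑-+ (allFin (2 + s)) (λ j → ⟦ pathEnd s (toℕ j) ⟧) (λ j → pathDegree (toℕ j))) ⟩
  ∑ (allFin (2 + s)) (λ j → ⟦ pathEnd s (toℕ j) ⟧ + pathDegree (toℕ j))
    ≡⟨ ∑-cong (allFin (2 + s)) (λ j → pathEnd+pathDegree s (toℕ j) (toℕ<n j)) ⟩
  ∑ (allFin (2 + s)) (λ _ → 2)                         ≡⟨ ∑-allFin-const (2 + s) 2 ⟩
  (2 + s) * 2                                          ≡⟨ distrib s ⟩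
  2 + 2 * (1 + s)                                      ∎)
  where
  distrib : ∀ s → (2 + s) * 2 ≡ 2 + 2 * (1 + s)
  distrib = solve-∀
  pathDegree : ℕ → ℕ
  pathDegree x = ∑ (allFin (2 + s)) (λ j' → ⟦ pathAdj x (toℕ j') ⟧)
  degrees : ℕ
  degrees = ∑ (allFin (2 + s)) (λ j → pathDegree (toℕ j))

square-shift : ∀ x y u v → (x + 2 * u + (y + 2 * v)) ^ 2 ≡ (x + y) ^ 2 + 4 * ((x + y) * (u + v)) + 4 * (u + v) ^ 2
square-shift = solve 4 (λ x y u v → (x :+ con 2 :* u :+ (y :+ con 2 :* v)) :^ 2
                                  := (x :+ y) :^ 2 :+ con 4 :* ((x :+ y) :* (u :+ v)) :+ con 4 :* (u :+ v) :^ 2) refl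

module AttachedCycles {n : ℕ} (a : Fin n → Fin n → Bool) (t : Fin n → ℕ) (s : ℕ) where

  r m : ℕ
  r = 3 + s
  m = 2 + s

  G H : Graph
  G = finGraph n a
  H = GC n a t r

  d : Fin n → ℕ
  d = deg G

  Slot : Set
  Slot = Σ (Fin n) (λ i → Fin (t i) × Fin m)

  slotsAt : (i : Fin n) → Fin (t i) → List Slot
  slotsAt i k = map (λ j → i , k , j) (allFin m)

  slots : List Slot
  slots = concatMap (λ i → concatMap (slotsAt i) (allFin (t i))) (allFin n)

  roots : List (CVert n t r)
  roots = map inj₁ (allFin n)

  verts-GC : verts H ≡ roots ++ map inj₂ slots
  verts-GC = cong (roots ++_) (sym (begin
    map inj₂ slots
      ≡⟨ map-concatMap inj₂ _ (allFin n) ⟩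
    concatMap (λ i → map inj₂ (concatMap (slotsAt i) (allFin (t i)))) (allFin n)
      ≡⟨ concatMap-cong (λ i → trans (map-concatMap inj₂ (slotsAt i) (allFin (t i)))
                                     (concatMap-cong (λ k → sym (map-∘ (allFin m))) (allFin (t i)))) (allFin n) ⟩
    concatMap (λ i → concatMap (λ k → map (λ j → inj₂ (i , k , j)) (allFin m)) (allFin (t i))) (allFin n) ∎))

  ∑-verts-GC : (f : CVert n t r → ℕ) → ∑ (verts H) f ≡ ∑ (allFin n) (f ∘ inj₁) + ∑ slots (f ∘ inj₂)
  ∑-verts-GC f = begin
    ∑ (verts H) f                         ≡⟨ cong (λ vs → ∑ vs f) verts-GC ⟩
    ∑ (roots ++ map inj₂ slots) f         ≡⟨ ∑-++ roots (map inj₂ slots) f ⟩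
    ∑ roots f + ∑ (map inj₂ slots) f      ≡⟨ cong₂ _+_ (∑-map inj₁ (allFin n) f) (∑-map inj₂ slots f) ⟩
    ∑ (allFin n) (f ∘ inj₁) + ∑ slots (f ∘ inj₂) ∎

  ∑-slots : (g : Slot → ℕ) → ∑ slots g ≡ ∑ (allFin n) (λ i → ∑ (allFin (t i)) (λ k → ∑ (allFin m) (λ j → g (i , k , j))))
  ∑-slots g = trans (∑-concatMap _ (allFin n) g) (∑-cong (allFin n) (λ i →
                trans (∑-concatMap (slotsAt i) (allFin (t i)) g) (∑-cong (allFin (t i)) (λ k →
                  ∑-map (λ j → i , k , j) (allFin m) g))))

  ∑-rootAdj : (i : Fin n) (K : ℕ) → ∑ slots (λ c → if rootAdj t r i c then K else 0) ≡ t i * (2 * K)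
  ∑-rootAdj i K = begin
    ∑ slots (λ c → if rootAdj t r i c then K else 0)
      ≡⟨ ∑-slots (λ c → if rootAdj t r i c then K else 0) ⟩
    ∑ (allFin n) (λ i' → ∑ (allFin (t i')) (λ k → ∑ (allFin m) (λ j → if eqFin i i' ∧ end j then K else 0)))
      ≡⟨ ∑-cong (allFin n) (λ i' → trans (∑-cong (allFin (t i')) (λ k →
            trans (∑-cong (allFin m) (λ j → if-∧ (eqFin i i') (end j) K)) (∑-if (allFin m) (eqFin i i') _)))
            (∑-if (allFin (t i')) (eqFin i i') _)) ⟩
    ∑ (allFin n) (λ i' → if eqFin i i' then ∑ (allFin (t i')) (λ _ → ends) else 0)
      ≡⟨ ∑-eqFin i (λ i' → ∑ (allFin (t i')) (λ _ → ends)) ⟩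
    ∑ (allFin (t i)) (λ _ → ends)         ≡⟨ ∑-allFin-const (t i) ends ⟩
    t i * ends                            ≡⟨ cong (t i *_) (∑-pathEnd s K) ⟩
    t i * (2 * K)                         ∎
    where
    end : Fin m → Bool
    end j = pathEnd s (toℕ j)
    ends : ℕ
    ends = ∑ (allFin m) (λ j → if end j then K else 0)

  ∑-cycAdj : (i : Fin n) (k : Fin (t i)) (j : Fin m) (K : ℕ) →
             ∑ slots (λ c' → if cycAdj t r (i , k , j) c' then K else 0)
             ≡ ∑ (allFin m) (λ j' → if pathAdj (toℕ j) (toℕ j') then K else 0)
  ∑-cycAdj i k j K = begin
    ∑ slots (λ c' → if cycAdj t r (i , k , j) c' then K else 0)
      ≡⟨ ∑-slots (λ c' → if cycAdj t r (i , k , j) c' then K else 0) ⟩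
    ∑ (allFin n) (λ i' → ∑ (allFin (t i')) (λ k' → ∑ (allFin m) (λ j' →
        if eqFin i i' ∧ ((toℕ k ≡ᵇ toℕ k') ∧ near j') then K else 0)))
      ≡⟨ ∑-cong (allFin n) (λ i' → trans (∑-cong (allFin (t i')) (λ k' →
            trans (∑-cong (allFin m) (λ j' → if-∧ (eqFin i i') _ K)) (∑-if (allFin m) (eqFin i i') _)))
            (∑-if (allFin (t i')) (eqFin i i') _)) ⟩
    ∑ (allFin n) (λ i' → if eqFin i i' then ∑ (allFin (t i')) (λ k' →
        ∑ (allFin m) (λ j' → if (toℕ k ≡ᵇ toℕ k') ∧ near j' then K else 0)) else 0)
      ≡⟨ ∑-eqFin i _ ⟩
    ∑ (allFin (t i)) (λ k' → ∑ (allFin m) (λ j' → if (toℕ k ≡ᵇ toℕ k') ∧ near j' then K else 0))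
      ≡⟨ ∑-cong (allFin (t i)) (λ k' → trans (∑-cong (allFin m) (λ j' → if-∧ (toℕ k ≡ᵇ toℕ k') (near j') K))
           (trans (∑-if (allFin m) (toℕ k ≡ᵇ toℕ k') _) (cong (λ b → if b then neighbours else 0) (≡ᵇ-sym (toℕ k) (toℕ k'))))) ⟩
    ∑ (allFin (t i)) (λ k' → if toℕ k' ≡ᵇ toℕ k then neighbours else 0)
      ≡⟨ ∑-toℕ≡ᵇ (t i) (toℕ k) neighbours (toℕ<n k) ⟩
    neighbours ∎
    where
    near : Fin m → Bool
    near j' = pathAdj (toℕ j) (toℕ j')
    neighbours : ℕ
    neighbours = ∑ (allFin m) (λ j' → if near j' then K else 0)

  deg-root : (i : Fin n) → deg H (inj₁ i) ≡ d i + 2 * t i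
  deg-root i = begin
    deg H (inj₁ i)                                           ≡⟨ ∑-verts-GC _ ⟩
    d i + ∑ slots (λ c → if rootAdj t r i c then 1 else 0)   ≡⟨ cong (d i +_) (∑-rootAdj i 1) ⟩
    d i + t i * 2                                            ≡⟨ cong (d i +_) (*-comm (t i) 2) ⟩
    d i + 2 * t i                                            ∎

  deg-slot : (c : Slot) → deg H (inj₂ c) ≡ 2
  deg-slot (i , k , j) = begin
    deg H (inj₂ (i , k , j))
      ≡⟨ ∑-verts-GC _ ⟩
    ∑ (allFin n) (λ i' → ⟦ eqFin i' i ∧ end ⟧) + ∑ slots (λ c' → ⟦ cycAdj t r (i , k , j) c' ⟧)
      ≡⟨ cong₂ _+_ (∑-cong (allFin n) (λ i' → trans (cong (λ b → ⟦ b ∧ end ⟧) (eqFin-sym i' i)) (if-∧ (eqFin i i') end 1)))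
                   (∑-cycAdj i k j 1) ⟩
    ∑ (allFin n) (λ i' → if eqFin i i' then ⟦ end ⟧ else 0) + ∑ (allFin m) (λ j' → ⟦ pathAdj (toℕ j) (toℕ j') ⟧)
      ≡⟨ cong (_+ _) (∑-eqFin i (λ _ → ⟦ end ⟧)) ⟩
    ⟦ end ⟧ + ∑ (allFin m) (λ j' → ⟦ pathAdj (toℕ j) (toℕ j') ⟧)
      ≡⟨ pathEnd+pathDegree s (toℕ j) (toℕ<n j) ⟩
    2 ∎
    where
    end : Bool
    end = pathEnd s (toℕ j)

  cycAdj-sym : (c c' : Slot) → cycAdj t r c c' ≡ cycAdj t r c' c
  cycAdj-sym (i , k , j) (i' , k' , j') =
    cong₂ _∧_ (eqFin-sym i i') (cong₂ _∧_ (≡ᵇ-sym (toℕ k) (toℕ k')) (pathAdj-sym (toℕ j) (toℕ j')))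

  cycAdj-irrefl : (c : Slot) → cycAdj t r c c ≡ false
  cycAdj-irrefl (i , k , j) rewrite eqFin-refl i | ≡ᵇ-refl (toℕ k) | suc≢ᵇ (toℕ j) = refl

  summand : CVert n t r → CVert n t r → ℕ
  summand u v = if adjC n a t r u v then (deg H u + deg H v) ^ 2 else 0

  HM-split : HM H ≡ ∑pairs (allFin n) (λ i j → summand (inj₁ i) (inj₁ j))
                    + ∑ (allFin n) (λ i → ∑ slots (summand (inj₁ i) ∘ inj₂))
                    + ∑pairs slots (λ c c' → summand (inj₂ c) (inj₂ c'))
  HM-split = begin
    ∑pairs (verts H) summand
      ≡⟨ cong (λ vs → ∑pairs vs summand) verts-GC ⟩
    ∑pairs (roots ++ map inj₂ slots) summand
      ≡⟨ ∑pairs-++ roots (map inj₂ slots) summand ⟩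
    ∑pairs roots summand + ∑ roots (λ u → ∑ (map inj₂ slots) (summand u)) + ∑pairs (map inj₂ slots) summand
      ≡⟨ cong₂ _+_ (cong₂ _+_ (∑pairs-map inj₁ (allFin n) summand)
                              (trans (∑-map inj₁ (allFin n) _) (∑-cong (allFin n) (λ i → ∑-map inj₂ slots _))))
                   (∑pairs-map inj₂ slots summand) ⟩
    ∑pairs (allFin n) (λ i j → summand (inj₁ i) (inj₁ j))
      + ∑ (allFin n) (λ i → ∑ slots (summand (inj₁ i) ∘ inj₂))
      + ∑pairs slots (λ c c' → summand (inj₂ c) (inj₂ c')) ∎

  rootEdgeTerms : ℕ
  rootEdgeTerms = HM G + 4 * sumE G (λ i j → (d i + d j) * (t i + t j)) + 4 * sumE G (λ i j → (t i + t j) ^ 2)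

  HM-roots : ∑pairs (allFin n) (λ i j → summand (inj₁ i) (inj₁ j)) ≡ rootEdgeTerms
  HM-roots = begin
    ∑ E (λ (i , j) → summand (inj₁ i) (inj₁ j))
      ≡⟨ ∑-cong E (λ (i , j) → expand i j) ⟩
    ∑ E (λ p → onEdge sq p + 4 * onEdge mixed p + 4 * onEdge tsq p)
      ≡⟨ ∑-+ E (λ p → onEdge sq p + 4 * onEdge mixed p) (λ p → 4 * onEdge tsq p) ⟩
    ∑ E (λ p → onEdge sq p + 4 * onEdge mixed p) + ∑ E (λ p → 4 * onEdge tsq p)
      ≡⟨ cong₂ _+_ (trans (∑-+ E (onEdge sq) (λ p → 4 * onEdge mixed p)) (cong (∑ E (onEdge sq) +_) (∑-* E 4 (onEdge mixed))))
                   (∑-* E 4 (onEdge tsq)) ⟩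
    ∑ E (onEdge sq) + 4 * ∑ E (onEdge mixed) + 4 * ∑ E (onEdge tsq) ∎
    where
    E : List (Fin n × Fin n)
    E = pairs (allFin n)
    onEdge : (Fin n → Fin n → ℕ) → Fin n × Fin n → ℕ
    onEdge f (i , j) = if a i j then f i j else 0
    sq mixed tsq : Fin n → Fin n → ℕ
    sq    i j = (d i + d j) ^ 2
    mixed i j = (d i + d j) * (t i + t j)
    tsq   i j = (t i + t j) ^ 2
    expand : (i j : Fin n) → summand (inj₁ i) (inj₁ j)
                           ≡ onEdge sq (i , j) + 4 * onEdge mixed (i , j) + 4 * onEdge tsq (i , j)
    expand i j = trans (cong₂ (λ x y → if a i j then (x + y) ^ 2 else 0) (deg-root i) (deg-root j)) (by-cases (a i j))
      where
      by-cases : (b : Bool) → (if b then (d i + 2 * t i + (d j + 2 * t j)) ^ 2 else 0)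
               ≡ (if b then sq i j else 0) + 4 * (if b then mixed i j else 0) + 4 * (if b then tsq i j else 0)
      by-cases true  = square-shift (d i) (d j) (t i) (t j)
      by-cases false = refl

  HM-spokes : ∑ (allFin n) (λ i → ∑ slots (summand (inj₁ i) ∘ inj₂))
              ≡ ∑ (allFin n) (λ i → t i * (2 * (d i + 2 * t i + 2) ^ 2))
  HM-spokes = ∑-cong (allFin n) (λ i → begin
    ∑ slots (summand (inj₁ i) ∘ inj₂)
      ≡⟨ ∑-cong slots (λ c → cong₂ (λ x y → if rootAdj t r i c then (x + y) ^ 2 else 0) (deg-root i) (deg-slot c)) ⟩
    ∑ slots (λ c → if rootAdj t r i c then (d i + 2 * t i + 2) ^ 2 else 0)
      ≡⟨ ∑-rootAdj i ((d i + 2 * t i + 2) ^ 2) ⟩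
    t i * (2 * (d i + 2 * t i + 2) ^ 2) ∎)

  ∑∑-cycleEdge : ∑ slots (λ c → ∑ slots (λ c' → if cycAdj t r c c' then 16 else 0))
                 ≡ ∑ (allFin n) (λ i → t i * (16 * (2 * (1 + s))))
  ∑∑-cycleEdge = begin
    ∑ slots (λ c → ∑ slots (λ c' → if cycAdj t r c c' then 16 else 0))
      ≡⟨ trans (∑-cong slots (λ (i , k , j) → ∑-cycAdj i k j 16)) (∑-slots _) ⟩
    ∑ (allFin n) (λ i → ∑ (allFin (t i)) (λ _ → ∑ (allFin m) (λ j → ∑ (allFin m) (pathEdge j))))
      ≡⟨ ∑-cong (allFin n) (λ i → trans (∑-cong (allFin (t i)) (λ _ → pathEdges)) (∑-allFin-const (t i) _)) ⟩
    ∑ (allFin n) (λ i → t i * (16 * (2 * (1 + s)))) ∎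
    where
    pathEdge : Fin m → Fin m → ℕ
    pathEdge j j' = if pathAdj (toℕ j) (toℕ j') then 16 else 0
    pathDegree : Fin m → ℕ
    pathDegree j = ∑ (allFin m) (λ j' → ⟦ pathAdj (toℕ j) (toℕ j') ⟧)
    pathEdges : ∑ (allFin m) (λ j → ∑ (allFin m) (pathEdge j)) ≡ 16 * (2 * (1 + s))
    pathEdges = begin
      ∑ (allFin m) (λ j → ∑ (allFin m) (pathEdge j))
        ≡⟨ ∑-cong (allFin m) (λ j → trans (∑-cong (allFin m) (λ j' → if-then-0 (pathAdj (toℕ j) (toℕ j')) 16))
                                          (∑-* (allFin m) 16 (λ j' → ⟦ pathAdj (toℕ j) (toℕ j') ⟧))) ⟩
      ∑ (allFin m) (λ j → 16 * pathDegree j)   ≡⟨ ∑-* (allFin m) 16 pathDegree ⟩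
      16 * ∑ (allFin m) pathDegree             ≡⟨ cong (16 *_) (∑∑-pathAdj s) ⟩
      16 * (2 * (1 + s))                       ∎

  HM-cycles : ∑pairs slots (λ c c' → summand (inj₂ c) (inj₂ c')) ≡ ∑ (allFin n) (λ i → t i * (16 * (1 + s)))
  HM-cycles = begin
    ∑pairs slots (λ c c' → summand (inj₂ c) (inj₂ c'))
      ≡⟨ ∑-cong (pairs slots) (λ (c , c') →
           cong₂ (λ x y → if cycAdj t r c c' then (x + y) ^ 2 else 0) (deg-slot c) (deg-slot c')) ⟩
    ∑pairs slots cycleEdge
      ≡⟨ *-cancelˡ-≡ _ _ 2 doubled ⟩
    ∑ (allFin n) (λ i → t i * (16 * (1 + s))) ∎
    where
    cycleEdge : Slot → Slot → ℕ
    cycleEdge c c' = if cycAdj t r c c' then 16 else 0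
    halve : ∀ x s → x * (16 * (2 * (1 + s))) ≡ 2 * (x * (16 * (1 + s)))
    halve = solve-∀
    doubled : 2 * ∑pairs slots cycleEdge ≡ 2 * ∑ (allFin n) (λ i → t i * (16 * (1 + s)))
    doubled = begin
      2 * ∑pairs slots cycleEdge
        ≡⟨ sym (∑pairs-handshake slots cycleEdge
                  (λ c c' → cong (λ b → if b then 16 else 0) (cycAdj-sym c c'))
                  (λ c → cong (λ b → if b then 16 else 0) (cycAdj-irrefl c))) ⟩
      ∑ slots (λ c → ∑ slots (cycleEdge c))              ≡⟨ ∑∑-cycleEdge ⟩
      ∑ (allFin n) (λ i → t i * (16 * (2 * (1 + s))))
        ≡⟨ trans (∑-cong (allFin n) (λ i → halve (t i) s)) (∑-* (allFin n) 2 _) ⟩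
      2 * ∑ (allFin n) (λ i → t i * (16 * (1 + s)))       ∎

  HM-GC : HM H ≡ rootEdgeTerms + ∑ (allFin n) (λ i → t i * (2 * (d i + 2 * t i + 2) ^ 2) + t i * (16 * (1 + s)))
  HM-GC = begin
    HM H
      ≡⟨ HM-split ⟩
    ∑pairs (allFin n) (λ i j → summand (inj₁ i) (inj₁ j))
      + ∑ (allFin n) (λ i → ∑ slots (summand (inj₁ i) ∘ inj₂))
      + ∑pairs slots (λ c c' → summand (inj₂ c) (inj₂ c'))
      ≡⟨ cong₂ _+_ (cong₂ _+_ HM-roots HM-spokes) HM-cycles ⟩
    rootEdgeTerms + ∑ (allFin n) spoke + ∑ (allFin n) cycle
      ≡⟨ trans (+-assoc rootEdgeTerms _ _) (cong (rootEdgeTerms +_) (sym (∑-+ (allFin n) spoke cycle))) ⟩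
    rootEdgeTerms + ∑ (allFin n) (λ i → spoke i + cycle i) ∎
    where
    spoke cycle : Fin n → ℕ
    spoke i = t i * (2 * (d i + 2 * t i + 2) ^ 2)
    cycle i = t i * (16 * (1 + s))

vertex-contribution : ∀ d t s → t * (2 * (d + 2 * t + 2) ^ 2) + t * (16 * (1 + s))
                              ≡ 2 * (t * d ^ 2) + 8 * (d * t ^ 2 + d * t + t ^ 3 + 2 * t ^ 2) + (24 + 16 * s) * t
vertex-contribution = solve 3 (λ d t s →
  t :* (con 2 :* (d :+ con 2 :* t :+ con 2) :^ 2) :+ t :* (con 16 :* (con 1 :+ s))
  := con 2 :* (t :* d :^ 2) :+ con 8 :* (d :* t :^ 2 :+ d :* t :+ t :^ 3 :+ con 2 :* t :^ 2) :+ (con 24 :+ con 16 :* s) :* t) refl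

16*[3+s]∸24≡24+16*s : (s : ℕ) → 16 * (3 + s) ∸ 24 ≡ 24 + 16 * s
16*[3+s]∸24≡24+16*s s = trans (cong (_∸ 24) (expand s)) (m+n∸m≡n 24 (24 + 16 * s))
  where
  expand : ∀ s → 16 * (3 + s) ≡ 24 + (24 + 16 * s)
  expand = solve-∀

mainTheorem2 : (n : ℕ) (a : Fin n → Fin n → Bool) →
    Symmetric a → Irreflexive a → Connected a →
    (t : Fin n → ℕ) (r : ℕ) → r ≥ 3 →
    let G = finGraph n a
        d = deg G
    in HM (GC n a t r) ≡
         HM G
         + 4 * sumE G (λ i j → (d i + d j) * (t i + t j))
         + 4 * sumE G (λ i j → (t i + t j) ^ 2)
         + 2 * sumV n (λ i → t i * d i ^ 2)
         + 8 * sumV n (λ i → d i * t i ^ 2 + d i * t i + t i ^ 3 + 2 * t i ^ 2)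
         + (16 * r ∸ 24) * sumV n t
mainTheorem2 n a _ _ _ t (suc (suc (suc s))) (s≤s (s≤s (s≤s _))) = begin
  HM H
    ≡⟨ HM-GC ⟩
  rootEdgeTerms + ∑ (allFin n) (λ i → t i * (2 * (d i + 2 * t i + 2) ^ 2) + t i * (16 * (1 + s)))
    ≡⟨ cong (rootEdgeTerms +_) (∑-cong (allFin n) (λ i → vertex-contribution (d i) (t i) s)) ⟩
  rootEdgeTerms + ∑ (allFin n) (λ i → 2 * X i + 8 * Y i + (24 + 16 * s) * t i)
    ≡⟨ cong (rootEdgeTerms +_) (∑-linear (allFin n) 2 8 (24 + 16 * s) X Y t) ⟩
  rootEdgeTerms + (2 * sumV n X + 8 * sumV n Y + (24 + 16 * s) * sumV n t)
    ≡⟨ cong (λ c → rootEdgeTerms + (2 * sumV n X + 8 * sumV n Y + c * sumV n t)) (sym (16*[3+s]∸24≡24+16*s s)) ⟩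
  rootEdgeTerms + (2 * sumV n X + 8 * sumV n Y + (16 * r ∸ 24) * sumV n t)
    ≡⟨ regroup rootEdgeTerms (2 * sumV n X) (8 * sumV n Y) ((16 * r ∸ 24) * sumV n t) ⟩
  rootEdgeTerms + 2 * sumV n X + 8 * sumV n Y + (16 * r ∸ 24) * sumV n t ∎
  where
  open AttachedCycles a t s
  X Y : Fin n → ℕ
  X i = t i * d i ^ 2
  Y i = d i * t i ^ 2 + d i * t i + t i ^ 3 + 2 * t i ^ 2
  regroup : ∀ w x y z → w + (x + y + z) ≡ w + x + y + z
  regroup = solve-∀
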